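{- Let ${\cal O}\subseteq{\it HML}_{\it FDP}$. Then the Approximation Induction Principle is sound for $\sim_{\cal O}$: for any labelled transition system and any states $s,q$ of its projection closure, if $\pi_n(s)\sim_{\cal O}\pi_n(q)$ for all $n\in\mathbb{N}$, then $s\sim_{\cal O}q$.
   Context: A labelled transition system consists of a set $S$ of states, a set $A$ of actions and transitions $s\xrightarrow{a}s'$. For each $n\in\mathbb{N}$ there is a projection operator $\pi_n$; the projection closure of the LTS has as states all expressions obtained from states of $S$ by finitely many applications of the operators $\pi_n$, with the original transitions together with the transitions given by the rule: if $x\xrightarrow{a}x'$ then $\pi_{n+1}(x)\xrightarrow{a}\pi_n(x')$ (these are the only transitions of projected states). Hennessy-Milner logic ${\it HML}$ has formulas $\varphi ::= {\sf T} \mid \bigwedge_{i\in I}\varphi_i \mid \langle a\rangle\varphi \mid \neg\varphi$ ($a\in A$, $I$ arbitrary index set), with the usual satisfaction relation ($s\models\langle a\rangle\varphi$ iff some $a$-successor of $s$ satisfies $\varphi$, conjunction and negation classical). The depth is $d({\sf T})=0$, $d(\bigwedge_{i\in I}\varphi_i)=\sup_i d(\varphi_i)$, $d(\langle a\rangle\varphi)=1+d(\varphi)$, $d(\neg\varphi)=d(\varphi)$; ${\it HML}_{\it FDP}$ is the set of formulas of finite depth. For ${\cal O}\subseteq{\it HML}$, $s\sim_{\cal O}q$ means $s$ and $q$ satisfy exactly the same formulas of ${\cal O}$. -}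

module Defs where

open import Data.Nat using (ℕ; zero; suc)
open import Data.Product using (Σ; _×_; ∃)
open import Relation.Nullary using (¬_)
open import Function.Bundles using (_⇔_)

record LTS : Set₁ where
  field
    State  : Set
    Action : Set
    _⟶[_]_ : State → Action → State → Set

data HML (A : Set) : Set₁ where
  T    : HML A
  ⋀    : (I : Set) → (I → HML A) → HML A
  ⟨_⟩_ : A → HML A → HML A
  ¬′   : HML A → HML A

-- Depth: d φ ≤ n  (d(⋀ φᵢ) = sup d(φᵢ), so d(⋀ φᵢ) ≤ n iff all d(φᵢ) ≤ n).
data DepthAtMost {A : Set} : ℕ → HML A → Set₁ where
  dT   : ∀ {n} → DepthAtMost n T
  d⋀   : ∀ {n I} {φ : I → HML A} → (∀ i → DepthAtMost n (φ i)) → DepthAtMost n (⋀ I φ)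
  d⟨⟩  : ∀ {n a φ} → DepthAtMost n φ → DepthAtMost (suc n) (⟨ a ⟩ φ)
  d¬   : ∀ {n φ} → DepthAtMost n φ → DepthAtMost n (¬′ φ)
  dsuc : ∀ {n φ} → DepthAtMost n φ → DepthAtMost (suc n) φ

-- Finite depth: the (supremum-defined) depth is a natural number, i.e. bounded.
FiniteDepth : {A : Set} → HML A → Set₁
FiniteDepth φ = Σ ℕ λ n → DepthAtMost n φ

module _ (L : LTS) where
  open LTS L
  _⊨_ : State → HML Action → Set
  s ⊨ T       = Data.Unit.⊤ where import Data.Unit
  s ⊨ ⋀ I φ   = (i : I) → s ⊨ φ i
  s ⊨ (⟨ a ⟩ φ) = Σ State λ s′ → (s ⟶[ a ] s′) × (s′ ⊨ φ)
  s ⊨ ¬′ φ    = ¬ (s ⊨ φ)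

  Equiv : (HML Action → Set₁) → State → State → Set₁
  Equiv O s q = (φ : HML Action) → O φ → (s ⊨ φ) ⇔ (q ⊨ φ)

module _ (L : LTS) where
  open LTS L
  data PState : Set where
    base : State → PState
    π    : ℕ → PState → PState

  data PStep : PState → Action → PState → Set where
    lift : ∀ {s a s′} → s ⟶[ a ] s′ → PStep (base s) a (base s′)
    proj : ∀ {n x a x′} → PStep x a x′ → PStep (π (suc n) x) a (π n x′)

  ProjClosure : LTS
  ProjClosure = record { State = PState ; Action = Action ; _⟶[_]_ = PStep }

module Submission where

-- The key observation is that projection does not affect formulas of bounded
-- depth: if d(φ) ≤ n ≤ m then  x ⊨ φ  iff  π m x ⊨ φ  for every state x of the
-- projection closure.  This is proved by induction on the depth derivation;
-- the only non-structural case is ⟨a⟩φ, where one uses that the a-successors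
-- of π (m+1) x are exactly the states π m x′ with x ⟶a x′.
--
-- The theorem then follows formula by formula: a formula φ ∈ O has some finite
-- depth n, and
--   s ⊨ φ  ⇔  π n s ⊨ φ  ⇔  π n q ⊨ φ  ⇔  q ⊨ φ,
-- the outer steps by projection invariance, the middle one by hypothesis.

open import Defs
open import Data.Nat using (ℕ; suc; _≤_; s≤s)
open import Data.Nat.Properties using (≤-refl; ≤-trans; n≤1+n)
open import Data.Product using (_,_)
open import Data.Unit using (tt)
open import Level using (0ℓ)
open import Function.Bundles using (_⇔_; mk⇔; Equivalence)
open import Function.Related.TypeIsomorphisms using (¬-cong-⇔)
open import Function.Properties.Equivalence using (⇔-setoid)
open import Relation.Binary.Reasoning.Setoid (⇔-setoid 0ℓ)

Π-cong-⇔ : {I : Set} {A B : I → Set} → (∀ i → A i ⇔ B i) → ((i : I) → A i) ⇔ ((i : I) → B i)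
Π-cong-⇔ A⇔B = mk⇔ (λ f i → Equivalence.to (A⇔B i) (f i))
                   (λ g i → Equivalence.from (A⇔B i) (g i))

module Satisfaction (L : LTS) where
  open LTS L using (Action)

  _⊨ᴾ_ : PState L → HML Action → Set
  _⊨ᴾ_ = _⊨_ (ProjClosure L)

  -- Since the a-successors of π (suc m) x are exactly the π m x′ with x ⟶a x′,
  -- the modality ⟨a⟩ commutes with one projection step whenever its body
  -- is invariant under π m.
  ⟨⟩-π : ∀ {m a} {φ : HML Action}
       → (∀ x′ → x′ ⊨ᴾ φ ⇔ π m x′ ⊨ᴾ φ)
       → ∀ x → x ⊨ᴾ (⟨ a ⟩ φ) ⇔ π (suc m) x ⊨ᴾ (⟨ a ⟩ φ)
  ⟨⟩-π {m} body x = mk⇔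
    (λ { (x′ , x⟶x′ , sat) → π m x′ , proj x⟶x′ , Equivalence.to (body x′) sat })
    (λ { (_ , proj {x′ = x′} x⟶x′ , sat) → x′ , x⟶x′ , Equivalence.from (body x′) sat })

  projection-invariance : ∀ {n} {φ : HML Action} → DepthAtMost n φ
                        → ∀ {m} → n ≤ m → ∀ x → x ⊨ᴾ φ ⇔ π m x ⊨ᴾ φ
  projection-invariance dT        n≤m x = mk⇔ (λ _ → tt) (λ _ → tt)
  projection-invariance (d⋀ dφ)   n≤m x = Π-cong-⇔ (λ i → projection-invariance (dφ i) n≤m x)
  projection-invariance (d⟨⟩ dφ) (s≤s n≤m) x = ⟨⟩-π (projection-invariance dφ n≤m) x
  projection-invariance (d¬ dφ)   n≤m x = ¬-cong-⇔ (projection-invariance dφ n≤m x)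
  projection-invariance (dsuc dφ) n≤m x = projection-invariance dφ (≤-trans (n≤1+n _) n≤m) x

theorem7 : (L : LTS) (O : HML (LTS.Action L) → Set₁)
    → ((φ : HML (LTS.Action L)) → O φ → FiniteDepth φ)
    → (s q : PState L)
    → ((n : ℕ) → Equiv (ProjClosure L) O (π n s) (π n q))
    → Equiv (ProjClosure L) O s q
theorem7 L O finite s q approx φ φ∈O with finite φ φ∈O
... | n , dφ = begin
  s ⊨ᴾ φ        ≈⟨ projection-invariance dφ ≤-refl s ⟩
  π n s ⊨ᴾ φ    ≈⟨ approx n φ φ∈O ⟩
  π n q ⊨ᴾ φ    ≈⟨ projection-invariance dφ ≤-refl q ⟨
  q ⊨ᴾ φ        ∎
  where open Satisfaction L using (_⊨ᴾ_; projection-invariance)
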